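{- Let $n\ge1$ and let $P=(P_0,P_1,\dots,P_{2^n-1})$ be a partition-sequence of $\{0,1\}^n$ such that $[|P_0|,|P_1|,\dots,|P_{2^n-1}|]$ is a block-sequence. Then the mapping $I_P$ on $\{0,1\}^n$ is suffix-compatible.
   Context: The index of $(x_1,\dots,x_n)\in\{0,1\}^n$ is $x_1+2x_2+\dots+2^{n-1}x_n$, and $X_i$ is the vector of index $i$. A partition-sequence of $\{0,1\}^n$ is a sequence $(P_0,\dots,P_k)$ of subsets whose non-empty members form a partition of $\{0,1\}^n$; $I_P$ is the mapping sending $X_0,X_1,\dots,X_{2^n-1}$ in order to $|P_0|$ copies of $X_0$, then $|P_1|$ copies of $X_1$, ..., then $|P_k|$ copies of $X_k$. A block-sequence is a sequence $[v_0,\dots,v_{2^n-1}]$ of non-negative integers such that for every $i=0,\dots,n$ and every $0\le j<2^{n-i}$, $\sum_{j2^i\le l<(j+1)2^i}v_l\equiv0\pmod{2^i}$. The suffix of order $k$ of $(x_1,\dots,x_n)$ is $(x_k,\dots,x_n)$. A mapping $I$ of $\{0,1\}^n$ is suffix-compatible if for every $1\le k\le n$, whenever $X,X'$ have the same suffix of order $k$, $I(X),I(X')$ also have the same suffix of order $k$. -}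

module Defs where

open import Data.Bool using (Bool; true; false; if_then_else_; T)
open import Data.Nat using (ℕ; zero; suc; _+_; _*_; _∸_; _^_; _≤_; _<_; _/_; _%_)
open import Data.Nat.Divisibility using (_∣_)
open import Data.Fin using (Fin; toℕ)
open import Data.List using (List; []; _∷_; map; concatMap; replicate; allFin; drop; upTo)
open import Data.Nat.ListAction using (sum)
open import Data.Vec using (Vec; []; _∷_; toList; tabulate)
open import Data.Product using (Σ; _×_)
open import Relation.Binary.PropositionalEquality using (_≡_)

-- Points of {0,1}^n : (x₁ , … , xₙ) with x₁ the head of the vector.
Cube : ℕ → Set
Cube n = Vec Bool n

bit : Bool → ℕ
bit true  = 1
bit false = 0

index : ∀ {n} → Cube n → ℕ
index []       = 0
index (b ∷ bs) = bit b + 2 * index bs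

X : ∀ n → ℕ → Cube n
X zero    i = []
X (suc n) i = isOne (i % 2) ∷ X n (i / 2)
  where
  isOne : ℕ → Bool
  isOne 1 = true
  isOne _ = false

allCube : ∀ n → List (Cube n)
allCube zero    = [] ∷ []
allCube (suc n) = concatMap (λ b → map (b ∷_) (allCube n)) (false ∷ true ∷ [])

Subset : ℕ → Set
Subset n = Cube n → Bool

card : ∀ {n} → Subset n → ℕ
card {n} S = sum (map (λ x → if S x then 1 else 0) (allCube n))

SubsetSeq : ℕ → Set
SubsetSeq n = Fin (2 ^ n) → Subset n

-- partition-sequence: the non-empty members form a partition of {0,1}ⁿ,
-- i.e. every point lies in exactly one Pᵢ
IsPartitionSeq : ∀ {n} → SubsetSeq n → Set
IsPartitionSeq {n} P =
  (x : Cube n) → Σ (Fin (2 ^ n)) λ i → T (P i x) × ((j : Fin (2 ^ n)) → T (P j x) → j ≡ i)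

-- list lookup with default 0 (default never used in range)
nth : List ℕ → ℕ → ℕ
nth []       _       = 0
nth (x ∷ xs) zero    = x
nth (x ∷ xs) (suc m) = nth xs m

rangeSum : (ℕ → ℕ) → ℕ → ℕ → ℕ
rangeSum v a len = sum (map (λ l → v (a + l)) (upTo len))

IsBlockSequence : ∀ n → Vec ℕ (2 ^ n) → Set
IsBlockSequence n v =
  (i : ℕ) → i ≤ n → (j : ℕ) → j < 2 ^ (n ∸ i) →
  (2 ^ i) ∣ rangeSum (nth (toList v)) (j * 2 ^ i) (2 ^ i)

cardSeq : ∀ {n} → SubsetSeq n → Vec ℕ (2 ^ n)
cardSeq P = tabulate (λ j → card (P j))

-- I_P : X₀,X₁,… ↦ |P₀| copies of X₀, then |P₁| copies of X₁, …
IPList : ∀ {n} → SubsetSeq n → List ℕ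
IPList {n} P = concatMap (λ j → replicate (card (P j)) (toℕ j)) (allFin (2 ^ n))

I : ∀ {n} → SubsetSeq n → Cube n → Cube n
I {n} P x = X n (nth (IPList P) (index x))

-- suffix of order k (k ≥ 1): (x_k,…,x_n) = drop (k-1)
suffix : ∀ {n} → ℕ → Cube n → List Bool
suffix k x = drop (k ∸ 1) (toList x)

SuffixCompatible : ∀ {n} → (Cube n → Cube n) → Set
SuffixCompatible {n} f =
  (k : ℕ) → 1 ≤ k → k ≤ n → (x x′ : Cube n) →
  suffix k x ≡ suffix k x′ → suffix k (f x) ≡ suffix k (f x′)

-- Put m = 2^(k-1). Two points share their suffix of order k exactly when their
-- indices have the same quotient by m, and X maps numbers with the same quotient
-- by m to points with the same suffix of order k. The list defining I_P is the
-- run-length expansion of the cardinalities |P_j|; cut into the groups of values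
-- j ∈ [J m, (J+1) m), the block condition at level k-1 makes every group a chunk of
-- length divisible by m all of whose entries have quotient J by m. Hence positions
-- with the same quotient by m read entries with the same quotient by m.
module Submission where

open import Defs
open import Data.Nat using (ℕ; zero; suc; _+_; _*_; _∸_; _^_; _≤_; _<_; _/_; NonZero; s≤s; z≤n)
open import Data.Nat.Properties
open import Data.Nat.DivMod
open import Data.Nat.Divisibility using (_∣_; divides; divides-refl)
open import Data.Nat.ListAction using (sum)
open import Data.Bool using (true; false)
open import Data.Fin using (Fin; toℕ) renaming (zero to fzero; suc to fsuc)
open import Data.List using (List; []; _∷_; _++_; map; concat; replicate; length; drop; applyUpTo; upTo)
import Data.List as List
open import Data.List.Properties
  using (length-++; length-replicate; map-tabulate; tabulate-cong; ++-assoc; map-applyUpTo; map-upTo; map-cong)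
open import Data.List.Relation.Unary.All using (All; []; _∷_)
import Data.List.Relation.Unary.All as All
open import Data.List.Relation.Unary.All.Properties using (++⁺; replicate⁺)
open import Data.Vec using (toList; tabulate) renaming (_∷_ to _∷ᵥ_; [] to []ᵥ)
open import Data.Vec.Properties using (toList-injective; cast-is-id)
open import Data.Product using (_×_; _,_)
open import Relation.Nullary using (yes; no; contradiction)
open import Relation.Binary.PropositionalEquality

nth-All : ∀ {P : ℕ → Set} (xs : List ℕ) {p} → All P xs → p < length xs → P (nth xs p)
nth-All (x ∷ xs) {zero}  (px ∷ _)   _         = px
nth-All (x ∷ xs) {suc p} (_  ∷ pxs) (s≤s p<n) = nth-All xs pxs p<n

nth-++ˡ : ∀ (xs ys : List ℕ) {p} → p < length xs → nth (xs ++ ys) p ≡ nth xs p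
nth-++ˡ (x ∷ xs) ys {zero}  _         = refl
nth-++ˡ (x ∷ xs) ys {suc p} (s≤s p<n) = nth-++ˡ xs ys p<n

nth-++ʳ : ∀ (xs ys : List ℕ) {p} → length xs ≤ p → nth (xs ++ ys) p ≡ nth ys (p ∸ length xs)
nth-++ʳ []       ys         _         = refl
nth-++ʳ (x ∷ xs) ys {suc p} (s≤s n≤p) = nth-++ʳ xs ys n≤p

nth-toList-tabulate : ∀ {N} (h : Fin N → ℕ) (j : Fin N) → nth (toList (tabulate h)) (toℕ j) ≡ h j
nth-toList-tabulate h fzero    = refl
nth-toList-tabulate h (fsuc j) = nth-toList-tabulate (λ k → h (fsuc k)) j

runs : (ℕ → ℕ) → ℕ → ℕ → List ℕ
runs c a zero      = []
runs c a (suc len) = replicate (c a) a ++ runs c (suc a) len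

rangeSum-suc : ∀ c a len → rangeSum c a (suc len) ≡ c a + rangeSum c (suc a) len
rangeSum-suc c a len = cong₂ _+_ (cong c (+-identityʳ a)) (cong sum (begin
    map (λ l → c (a + l)) (applyUpTo suc len)   ≡⟨ map-applyUpTo suc (λ l → c (a + l)) len ⟩
    applyUpTo (λ l → c (a + suc l)) len          ≡⟨ map-upTo (λ l → c (a + suc l)) len ⟨
    map (λ l → c (a + suc l)) (upTo len)         ≡⟨ map-cong (λ l → cong c (+-suc a l)) (upTo len) ⟩
    map (λ l → c (suc a + l)) (upTo len)         ∎))
  where open ≡-Reasoning

length-runs : ∀ c a len → length (runs c a len) ≡ rangeSum c a len
length-runs c a zero      = refl
length-runs c a (suc len) = begin
  length (replicate (c a) a ++ runs c (suc a) len)        ≡⟨ length-++ (replicate (c a) a) ⟩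
  length (replicate (c a) a) + length (runs c (suc a) len) ≡⟨ cong₂ _+_ (length-replicate (c a)) (length-runs c (suc a) len) ⟩
  c a + rangeSum c (suc a) len                            ≡⟨ rangeSum-suc c a len ⟨
  rangeSum c a (suc len)                                  ∎
  where open ≡-Reasoning

runs-+ : ∀ c a x y → runs c a (x + y) ≡ runs c a x ++ runs c (a + x) y
runs-+ c a zero    y = cong (λ b → runs c b y) (sym (+-identityʳ a))
runs-+ c a (suc x) y = begin
  replicate (c a) a ++ runs c (suc a) (x + y)                          ≡⟨ cong (replicate (c a) a ++_) (runs-+ c (suc a) x y) ⟩
  replicate (c a) a ++ (runs c (suc a) x ++ runs c (suc a + x) y)     ≡⟨ ++-assoc (replicate (c a) a) _ _ ⟨
  (replicate (c a) a ++ runs c (suc a) x) ++ runs c (suc a + x) y     ≡⟨ cong (λ b → (replicate (c a) a ++ runs c (suc a) x) ++ runs c b y) (+-suc a x) ⟨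
  (replicate (c a) a ++ runs c (suc a) x) ++ runs c (a + suc x) y     ∎
  where open ≡-Reasoning

runs-bounded : ∀ c a len → All (λ e → a ≤ e × e < a + len) (runs c a len)
runs-bounded c a zero      = []
runs-bounded c a (suc len) =
  ++⁺ (replicate⁺ (c a) (≤-refl , m<m+n a (s≤s z≤n)))
      (All.map (λ {e} (a<e , e<) → <⇒≤ a<e , subst (e <_) (sym (+-suc a len)) e<) (runs-bounded c (suc a) len))

concat-tabulate-runs : ∀ {N} (h : Fin N → ℕ) c a → (∀ j → c (a + toℕ j) ≡ h j) →
                       concat (List.tabulate (λ j → replicate (h j) (a + toℕ j))) ≡ runs c a N
concat-tabulate-runs {zero}  h c a c≡h = refl
concat-tabulate-runs {suc N} h c a c≡h = cong₂ _++_ head tail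
  where
  head : replicate (h fzero) (a + 0) ≡ replicate (c a) a
  head = cong₂ replicate (trans (sym (c≡h fzero)) (cong c (+-identityʳ a))) (+-identityʳ a)
  tail : concat (List.tabulate (λ j → replicate (h (fsuc j)) (a + suc (toℕ j)))) ≡ runs c (suc a) N
  tail = trans (cong concat (tabulate-cong (λ j → cong (replicate (h (fsuc j))) (+-suc a (toℕ j)))))
               (concat-tabulate-runs (λ j → h (fsuc j)) c (suc a)
                  (λ j → trans (cong c (sym (+-suc a (toℕ j)))) (c≡h (fsuc j))))

IPList≡runs : ∀ {n} (P : SubsetSeq n) → IPList P ≡ runs (nth (toList (cardSeq P))) 0 (2 ^ n)
IPList≡runs {n} P =
  trans (cong concat (map-tabulate (λ j → j) (λ j → replicate (card (P j)) (toℕ j))))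
        (concat-tabulate-runs (λ j → card (P j)) _ 0 (nth-toList-tabulate (λ j → card (P j))))

module Blocks (m : ℕ) .{{_ : NonZero m}} where

  BlockPreserving : List ℕ → Set
  BlockPreserving xs = ∀ {p p'} → p / m ≡ p' / m → nth xs p / m ≡ nth xs p' / m

  *-≤⇒≤-/ : ∀ {r p} → r * m ≤ p → r ≤ p / m
  *-≤⇒≤-/ {r} r*m≤p = subst (_≤ _) (m*n/n≡m r m) (/-monoˡ-≤ m r*m≤p)

  /-inBlock : ∀ {J e} → J * m ≤ e → e < J * m + m → e / m ≡ J
  /-inBlock {J} {e} lo hi = ≤-antisym (≤-pred (m<n*o⇒m/o<n (subst (e <_) (+-comm (J * m) m) hi))) (*-≤⇒≤-/ lo)

  sameBlock-< : ∀ {n p p'} → m ∣ n → p / m ≡ p' / m → p < n → p' < n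
  sameBlock-< (divides-refl r) p~p' p<rm =
    ≰⇒> λ rm≤p' → <⇒≱ (m<n*o⇒m/o<n p<rm) (subst (r ≤_) (sym p~p') (*-≤⇒≤-/ rm≤p'))

  sameBlock-∸ : ∀ {n p p'} → m ∣ n → p / m ≡ p' / m → (p ∸ n) / m ≡ (p' ∸ n) / m
  sameBlock-∸ {p = p} {p'} (divides-refl r) p~p' =
    trans ([m∸n*o]/o≡m/o∸n p r m) (trans (cong (_∸ r) p~p') (sym ([m∸n*o]/o≡m/o∸n p' r m)))

  ++-blockPreserving : ∀ {J} (xs ys : List ℕ) → m ∣ length xs → All (λ e → e / m ≡ J) xs →
                       BlockPreserving ys → BlockPreserving (xs ++ ys)
  ++-blockPreserving {J} xs ys m∣|xs| xs∈J ys-pres {p} {p'} p~p'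
    with p <? length xs | p' <? length xs
  ... | yes p<  | yes p'< = begin
    nth (xs ++ ys) p / m   ≡⟨ cong (_/ m) (nth-++ˡ xs ys p<) ⟩
    nth xs p / m           ≡⟨ nth-All xs xs∈J p< ⟩
    J                      ≡⟨ nth-All xs xs∈J p'< ⟨
    nth xs p' / m          ≡⟨ cong (_/ m) (nth-++ˡ xs ys p'<) ⟨
    nth (xs ++ ys) p' / m  ∎
    where open ≡-Reasoning
  ... | no p≮   | no p'≮  = begin
    nth (xs ++ ys) p / m                ≡⟨ cong (_/ m) (nth-++ʳ xs ys (≮⇒≥ p≮)) ⟩
    nth ys (p ∸ length xs) / m          ≡⟨ ys-pres (sameBlock-∸ m∣|xs| p~p') ⟩
    nth ys (p' ∸ length xs) / m         ≡⟨ cong (_/ m) (nth-++ʳ xs ys (≮⇒≥ p'≮)) ⟨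
    nth (xs ++ ys) p' / m               ∎
    where open ≡-Reasoning
  ... | yes p<  | no p'≮  = contradiction (sameBlock-< m∣|xs| p~p' p<) p'≮
  ... | no p≮   | yes p'< = contradiction (sameBlock-< m∣|xs| (sym p~p') p'<) p≮

  runs-blockPreserving : ∀ c q J → (∀ J' → J ≤ J' → J' < J + q → m ∣ rangeSum c (J' * m) m) →
                         BlockPreserving (runs c (J * m) (q * m))
  runs-blockPreserving c zero    J m∣ _ = refl
  runs-blockPreserving c (suc q) J m∣ rewrite runs-+ c (J * m) m (q * m) | +-comm (J * m) m =
    ++-blockPreserving (runs c (J * m) m) _ m∣|block| block∈J
      (runs-blockPreserving c q (suc J) (λ J' J<J' J'< → m∣ J' (<⇒≤ J<J') (subst (J' <_) (sym (+-suc J q)) J'<)))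
    where
    m∣|block| : m ∣ length (runs c (J * m) m)
    m∣|block| = subst (m ∣_) (sym (length-runs c (J * m) m)) (m∣ J ≤-refl (m<m+n J (s≤s z≤n)))
    block∈J : All (λ e → e / m ≡ J) (runs c (J * m) m)
    block∈J = All.map (λ (lo , hi) → /-inBlock lo hi) (runs-bounded c (J * m) m)

-- Division by 2^i through repeated halving, which is how both index and X see it.
_/2^_ : ℕ → ℕ → ℕ
v /2^ zero  = v
v /2^ suc i = (v / 2) /2^ i

/2^≡/ : ∀ v i → v /2^ i ≡ _/_ v (2 ^ i) {{m^n≢0 2 i}}
/2^≡/ v zero    = sym (n/1≡n v)
/2^≡/ v (suc i) = trans (/2^≡/ (v / 2) i) (m/n/o≡m/[n*o] v 2 (2 ^ i) {{_}} {{m^n≢0 2 i}} {{m^n≢0 2 (suc i)}})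

index-∷-/2 : ∀ {n} b (x : Cube n) → index (b ∷ᵥ x) / 2 ≡ index x
index-∷-/2 b x = trans (+-distrib-/-∣ʳ (bit b) (divides (index x) (*-comm 2 (index x))))
                       (cong₂ _+_ (bit/2≡0 b) (trans (cong (_/ 2) (*-comm 2 (index x))) (m*n/n≡m (index x) 2)))
  where
  bit/2≡0 : ∀ b → bit b / 2 ≡ 0
  bit/2≡0 true  = refl
  bit/2≡0 false = refl

index-/2^-drop : ∀ {n} i (x x' : Cube n) → drop i (toList x) ≡ drop i (toList x') → index x /2^ i ≡ index x' /2^ i
index-/2^-drop zero    x          x'           x≡x' =
  cong index (trans (sym (cast-is-id refl x)) (toList-injective refl x x' x≡x'))
index-/2^-drop (suc i) []ᵥ        []ᵥ          _    = refl
index-/2^-drop (suc i) (b ∷ᵥ x) (b' ∷ᵥ x') x~x' =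
  subst₂ (λ v v' → v /2^ i ≡ v' /2^ i) (sym (index-∷-/2 b x)) (sym (index-∷-/2 b' x')) (index-/2^-drop i x x' x~x')

drop-X-/2^ : ∀ n i v v' → v /2^ i ≡ v' /2^ i → drop i (toList (X n v)) ≡ drop i (toList (X n v'))
drop-X-/2^ n       zero    v v' v≡v' = cong (λ w → toList (X n w)) v≡v'
drop-X-/2^ zero    (suc i) v v' _    = refl
drop-X-/2^ (suc n) (suc i) v v' v~v' = drop-X-/2^ n i (v / 2) (v' / 2) v~v'

lemma21 : (n : ℕ) → 1 ≤ n → (P : SubsetSeq n) → IsPartitionSeq P →
          IsBlockSequence n (cardSeq P) → SuffixCompatible (I P)
lemma21 n _ P _ block k _ k≤n x x' x~x' =
  drop-X-/2^ n i _ _ (IPList-preserving (index-/2^-drop i x x' x~x'))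
  where
  i : ℕ
  i = k ∸ 1
  i≤n : i ≤ n
  i≤n = ≤-trans (m∸n≤m k 1) k≤n
  open Blocks (2 ^ i) {{m^n≢0 2 i}}
  2^n≡blocks : 2 ^ (n ∸ i) * 2 ^ i ≡ 2 ^ n
  2^n≡blocks = trans (sym (^-distribˡ-+-* 2 (n ∸ i) i)) (cong (2 ^_) (m∸n+n≡m i≤n))
  IPList-blockPreserving : BlockPreserving (IPList P)
  IPList-blockPreserving = subst BlockPreserving (trans (cong (runs _ 0) 2^n≡blocks) (sym (IPList≡runs P)))
    (runs-blockPreserving _ (2 ^ (n ∸ i)) 0 (λ J' _ J'< → block i i≤n J' J'<))
  IPList-preserving : ∀ {p p'} → p /2^ i ≡ p' /2^ i → nth (IPList P) p /2^ i ≡ nth (IPList P) p' /2^ i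
  IPList-preserving {p} {p'} p~p' = subst₂ _≡_ (sym (/2^≡/ _ i)) (sym (/2^≡/ _ i))
    (IPList-blockPreserving (subst₂ _≡_ (/2^≡/ p i) (/2^≡/ p' i) p~p'))
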